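{- Let $(\mathbf{C},\mathcal M)$ be an $\mathcal M$-adhesive category with binary coproducts. Let $p_1=(L_1\leftarrow I_1\rightarrow R_1)$ and $p_2=(L_2\leftarrow I_2\rightarrow R_2)$ be plain rules, let $tp\colon H_1\Leftarrow_{p_1,m_1}G\Rightarrow_{p_2,m_2}H_2$ be a parallel independent pair of plain direct transformations, and let $tp_{L_1+L_2}\colon R_1+L_2\Leftarrow_{p_1,i_1}L_1+L_2\Rightarrow_{p_2,i_2}L_1+R_2$ be the pair obtained by applying $p_1$ and $p_2$ at the coproduct injections $i_1\colon L_1\to L_1+L_2$, $i_2\colon L_2\to L_1+L_2$. Let $m\colon L_1+L_2\to G$ be the unique morphism with $m\circ i_1=m_1$ and $m\circ i_2=m_2$. Then $m$ defines extension diagrams embedding $tp_{L_1+L_2}$ into $tp$, i.e. $tp_{L_1+L_2}$ can be embedded into $tp$ via extension morphism $m$.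
   Context: An $\mathcal M$-adhesive category is a category with a distinguished class $\mathcal M$ of monomorphisms satisfying the standard axioms (including the van Kampen property for pushouts along $\mathcal M$-morphisms). A plain rule $p=(L\leftarrow I\rightarrow R)$ has both morphisms in $\mathcal M$. A plain direct transformation $G\Rightarrow_{p,m}H$ with match $m\colon L\to G$ is a double pushout diagram with intermediate object $D$, $k\colon D\to G$, $c\colon D\to H$. A pair $H_1\Leftarrow_{p_1,m_1}G\Rightarrow_{p_2,m_2}H_2$ (with $k_i\colon D_i\to G$) is parallel independent if there exist $d_{12}\colon L_1\to D_2$ with $k_2\circ d_{12}=m_1$ and $d_{21}\colon L_2\to D_1$ with $k_1\circ d_{21}=m_2$. A pair $tp'\colon P_1\Leftarrow_{p_1,o_1}K\Rightarrow_{p_2,o_2}P_2$ can be embedded into $tp\colon H_1\Leftarrow_{p_1,m_1}G\Rightarrow_{p_2,m_2}H_2$ via extension morphism $f\colon K\to G$ if $m_j=f\circ o_j$ and for each $j=1,2$ there are morphisms from the intermediate and result objects of the $j$-th upper transformation to those of the $j$-th lower transformation making all squares between the two double pushout diagrams commute and be pushouts (extension diagrams). -}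

module Defs where

open import Level using (Level; _⊔_; suc)
open import Relation.Binary.PropositionalEquality using (_≡_)
open import Data.Product using (Σ; Σ-syntax; _×_; _,_; proj₁)

∃!-syntax : ∀ {a p} (A : Set a) → (A → Set p) → Set (a ⊔ p)
∃!-syntax A P = Σ[ x ∈ A ] (P x × (∀ y → P y → x ≡ y))
syntax ∃!-syntax A (λ x → P) = ∃![ x ∈ A ] P

record Category (o ℓ : Level) : Set (suc (o ⊔ ℓ)) where
  infixr 9 _∘_
  field
    Obj   : Set o
    Hom   : Obj → Obj → Set ℓ
    id    : ∀ {A} → Hom A A
    _∘_   : ∀ {A B C} → Hom B C → Hom A B → Hom A C
    assoc : ∀ {A B C D} (h : Hom C D) (g : Hom B C) (f : Hom A B) →
            (h ∘ g) ∘ f ≡ h ∘ (g ∘ f)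
    identityˡ : ∀ {A B} (f : Hom A B) → id ∘ f ≡ f
    identityʳ : ∀ {A B} (f : Hom A B) → f ∘ id ≡ f

module _ {o ℓ : Level} (𝒞 : Category o ℓ) where
  open Category 𝒞

  Mono : ∀ {A B} → Hom A B → Set (o ⊔ ℓ)
  Mono {A} f = ∀ {X} (g h : Hom X A) → f ∘ g ≡ f ∘ h → g ≡ h

  record IsIso {A B} (f : Hom A B) : Set ℓ where
    field
      inv  : Hom B A
      invˡ : inv ∘ f ≡ id
      invʳ : f ∘ inv ≡ id

  -- The square
  --     A --f--> B
  --     |g       |g'
  --     v        v
  --     C --f'-> D
  -- is a pushout of the span (f , g).
  record IsPushout {A B C D} (f : Hom A B) (g : Hom A C)
                   (g' : Hom B D) (f' : Hom C D) : Set (o ⊔ ℓ) where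
    field
      commute   : g' ∘ f ≡ f' ∘ g
      universal : ∀ {X} (h : Hom B X) (k : Hom C X) → h ∘ f ≡ k ∘ g →
                  ∃![ u ∈ Hom D X ] ((u ∘ g' ≡ h) × (u ∘ f' ≡ k))

  record IsPullback {A B C D} (f : Hom A B) (g : Hom A C)
                    (g' : Hom B D) (f' : Hom C D) : Set (o ⊔ ℓ) where
    field
      commute   : g' ∘ f ≡ f' ∘ g
      universal : ∀ {X} (h : Hom X B) (k : Hom X C) → g' ∘ h ≡ f' ∘ k →
                  ∃![ u ∈ Hom X A ] ((f ∘ u ≡ h) × (g ∘ u ≡ k))

  record Coproduct (A B : Obj) : Set (o ⊔ ℓ) where
    field
      A+B : Obj
      i₁  : Hom A A+B
      i₂  : Hom B A+B
      universal : ∀ {X} (f : Hom A X) (g : Hom B X) →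
                  ∃![ u ∈ Hom A+B X ] ((u ∘ i₁ ≡ f) × (u ∘ i₂ ≡ g))

  BinaryCoproducts : Set (o ⊔ ℓ)
  BinaryCoproducts = ∀ A B → Coproduct A B

  copair : ∀ {A B X} (cp : Coproduct A B) →
           Hom A X → Hom B X → Hom (Coproduct.A+B cp) X
  copair cp f g = proj₁ (Coproduct.universal cp f g)

module _ {o ℓ : Level} (𝒞 : Category o ℓ) where
  open Category 𝒞

  -- Vertical weak van Kampen property of the bottom square
  --   A --f--> B ,  A --g--> C ,  B --g'--> D ,  C --f'--> D
  -- w.r.t. a class M: for every commutative cube over it
  --   top:      A' --f₁--> B', A' --g₁--> C', B' --g₁'--> D', C' --f₁'--> D'
  --   vertical: a : A' → A, b : B' → B, c : C' → C, d : D' → D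
  -- with b, c, d ∈ M and both back faces pullbacks, the top face is a
  -- pushout iff both front faces are pullbacks.
  VerticalWeakVK : ∀ {m} (M : ∀ {A B} → Hom A B → Set m)
                   {A B C D} (f : Hom A B) (g : Hom A C)
                   (g' : Hom B D) (f' : Hom C D) → Set (o ⊔ ℓ ⊔ m)
  VerticalWeakVK M {A} {B} {C} {D} f g g' f' =
    ∀ {A' B' C' D'}
      (f₁ : Hom A' B') (g₁ : Hom A' C') (g₁' : Hom B' D') (f₁' : Hom C' D')
      (a : Hom A' A) (b : Hom B' B) (c : Hom C' C) (d : Hom D' D) →
      g₁' ∘ f₁ ≡ f₁' ∘ g₁ →
      f ∘ a ≡ b ∘ f₁ → g ∘ a ≡ c ∘ g₁ →
      g' ∘ b ≡ d ∘ g₁' → f' ∘ c ≡ d ∘ f₁' →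
      M b → M c → M d →
      IsPullback 𝒞 a f₁ f b →
      IsPullback 𝒞 a g₁ g c →
      (IsPushout 𝒞 f₁ g₁ g₁' f₁' →
         IsPullback 𝒞 b g₁' g' d × IsPullback 𝒞 c f₁' f' d)
      × (IsPullback 𝒞 b g₁' g' d → IsPullback 𝒞 c f₁' f' d →
         IsPushout 𝒞 f₁ g₁ g₁' f₁')

  record MAdhesive (m : Level) : Set (suc m ⊔ o ⊔ ℓ) where
    field
      M          : ∀ {A B} → Hom A B → Set m
      M-mono     : ∀ {A B} (f : Hom A B) → M f → Mono 𝒞 f
      M-iso      : ∀ {A B} (f : Hom A B) → IsIso 𝒞 f → M f
      M-comp     : ∀ {A B C} (g : Hom B C) (f : Hom A B) → M g → M f → M (g ∘ f)
      M-decomp   : ∀ {A B C} (g : Hom B C) (f : Hom A B) → M (g ∘ f) → M g → M f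
      pushout-M  : ∀ {A B C} (f : Hom A B) (g : Hom A C) → M f →
                   Σ[ D ∈ Obj ] Σ[ g' ∈ Hom B D ] Σ[ f' ∈ Hom C D ]
                     IsPushout 𝒞 f g g' f'
      pullback-M : ∀ {B C D} (g' : Hom B D) (f' : Hom C D) → M g' →
                   Σ[ A ∈ Obj ] Σ[ f ∈ Hom A B ] Σ[ g ∈ Hom A C ]
                     IsPullback 𝒞 f g g' f'
      M-pushout-stable  : ∀ {A B C D} (f : Hom A B) (g : Hom A C)
                          (g' : Hom B D) (f' : Hom C D) →
                          IsPushout 𝒞 f g g' f' → M f → M f'
      M-pullback-stable : ∀ {A B C D} (f : Hom A B) (g : Hom A C)
                          (g' : Hom B D) (f' : Hom C D) →
                          IsPullback 𝒞 f g g' f' → M g' → M g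
      van-Kampen : ∀ {A B C D} (f : Hom A B) (g : Hom A C)
                   (g' : Hom B D) (f' : Hom C D) →
                   M f → IsPushout 𝒞 f g g' f' → VerticalWeakVK M f g g' f'

module _ {o ℓ m : Level} {𝒞 : Category o ℓ} (𝓜 : MAdhesive 𝒞 m) where
  open Category 𝒞
  open MAdhesive 𝓜

  record Rule : Set (o ⊔ ℓ ⊔ m) where
    field
      L I R : Obj
      l   : Hom I L
      r   : Hom I R
      l∈M : M l
      r∈M : M r

  -- plain direct transformation  G ⇒_{p,mt} H  (double pushout)
  --     L <-l-- I --r--> R
  --     |mt     |d       |n
  --     G <-k-- D --c--> H
  record DirectTransformation (p : Rule) {G : Obj} (mt : Hom (Rule.L p) G)
         : Set (o ⊔ ℓ) where
    open Rule p
    field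
      D     : Obj
      H     : Obj
      d     : Hom I D
      k     : Hom D G
      n     : Hom R H
      c     : Hom D H
      left  : IsPushout 𝒞 l d mt k
      right : IsPushout 𝒞 r d n c

  ParallelIndependent :
    {p₁ p₂ : Rule} {G : Obj}
    {m₁ : Hom (Rule.L p₁) G} {m₂ : Hom (Rule.L p₂) G} →
    DirectTransformation p₁ m₁ → DirectTransformation p₂ m₂ → Set ℓ
  ParallelIndependent {p₁} {p₂} {m₁ = m₁} {m₂} t₁ t₂ =
    Σ[ d₁₂ ∈ Hom (Rule.L p₁) (DirectTransformation.D t₂) ]
      (DirectTransformation.k t₂ ∘ d₁₂ ≡ m₁)
    × Σ[ d₂₁ ∈ Hom (Rule.L p₂) (DirectTransformation.D t₁) ]
      (DirectTransformation.k t₁ ∘ d₂₁ ≡ m₂)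

  -- Extension diagram: the upper transformation K ⇒_{p,o} P is embedded into
  -- the lower G ⇒_{p,mt} H via f : K → G, i.e. mt = f ∘ o and there are
  -- d : D' → D, h : P → H such that
  --     L <-- I --> R
  --     |o    |     |
  --     K <-- D' -> P
  --     |f    |d    |h
  --     G <-- D --> H
  -- commutes and the two lower squares are pushouts.
  record ExtensionDiagram (p : Rule) {K G : Obj}
         {o' : Hom (Rule.L p) K} {mt : Hom (Rule.L p) G}
         (u : DirectTransformation p o') (t : DirectTransformation p mt)
         (f : Hom K G) : Set (o ⊔ ℓ) where
    module U = DirectTransformation u
    module T = DirectTransformation t
    field
      match-eq : mt ≡ f ∘ o'
      dD       : Hom U.D T.D
      hH       : Hom U.H T.H
      I-eq     : dD ∘ U.d ≡ T.d
      R-eq     : hH ∘ U.n ≡ T.n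
      left-po  : IsPushout 𝒞 U.k dD f T.k
      right-po : IsPushout 𝒞 U.c dD hH T.c

  Embeds : {p₁ p₂ : Rule} {K G : Obj}
           {o₁ : Hom (Rule.L p₁) K} {o₂ : Hom (Rule.L p₂) K}
           {m₁ : Hom (Rule.L p₁) G} {m₂ : Hom (Rule.L p₂) G} →
           DirectTransformation p₁ o₁ → DirectTransformation p₂ o₂ →
           DirectTransformation p₁ m₁ → DirectTransformation p₂ m₂ →
           Hom K G → Set (o ⊔ ℓ)
  Embeds {p₁} {p₂} u₁ u₂ t₁ t₂ f =
    ExtensionDiagram p₁ u₁ t₁ f × ExtensionDiagram p₂ u₂ t₂ f

-- Applying p at the injection i₁ : L₁ → L₁ + L₂ has, up to isomorphism,
-- the pushout complement I₁ + L₂ (pushout complements along M are unique,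
-- by the van Kampen property).  Parallel independence supplies
-- d₂₁ : L₂ → D₁, so [d₁ , d₂₁] : I₁ + L₂ → D₁ relates the two left squares;
-- since the upper square and the composite square are pushouts, so is the
-- lower one, and the same pushout cancellation handles the right-hand side.
module Submission where

open import Defs
open import Level using (Level)
open import Data.Product using (Σ-syntax; _×_; _,_; proj₁; proj₂)
open import Relation.Binary.PropositionalEquality
  using (_≡_; refl; sym; trans; cong; module ≡-Reasoning)

module CategoryProperties {o ℓ : Level} (𝒞 : Category o ℓ) where
  open Category 𝒞
  open ≡-Reasoning

  pullˡ : ∀ {A B C D} {g : Hom C D} {f : Hom B C} {h : Hom B D} (x : Hom A B) →
          g ∘ f ≡ h → g ∘ (f ∘ x) ≡ h ∘ x
  pullˡ {g = g} {f} x e = trans (sym (assoc g f x)) (cong (_∘ x) e)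

  pullʳ : ∀ {A B C D} (g : Hom C D) {f : Hom B C} {x : Hom A B} {h : Hom A C} →
          f ∘ x ≡ h → (g ∘ f) ∘ x ≡ g ∘ h
  pullʳ g {f} {x} e = trans (assoc g f x) (cong (g ∘_) e)

  id-comm : ∀ {A B} (f : Hom A B) → f ∘ id ≡ id ∘ f
  id-comm f = trans (identityʳ f) (sym (identityˡ f))

  module _ {A B : Obj} (c : Coproduct 𝒞 A B) where
    open Coproduct c

    copair-i₁ : ∀ {X} (f : Hom A X) (g : Hom B X) → copair 𝒞 c f g ∘ i₁ ≡ f
    copair-i₁ f g = proj₁ (proj₁ (proj₂ (universal f g)))

    copair-i₂ : ∀ {X} (f : Hom A X) (g : Hom B X) → copair 𝒞 c f g ∘ i₂ ≡ g
    copair-i₂ f g = proj₂ (proj₁ (proj₂ (universal f g)))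

    coproduct-ext : ∀ {X} {u v : Hom A+B X} → u ∘ i₁ ≡ v ∘ i₁ → u ∘ i₂ ≡ v ∘ i₂ → u ≡ v
    coproduct-ext {u = u} {v} e₁ e₂ = trans (sym (unique u (e₁ , e₂))) (unique v (refl , refl))
      where unique = proj₂ (proj₂ (universal (v ∘ i₁) (v ∘ i₂)))

  Coproduct-swap : ∀ {A B} → Coproduct 𝒞 A B → Coproduct 𝒞 B A
  Coproduct-swap c = record
    { A+B = A+B ; i₁ = i₂ ; i₂ = i₁
    ; universal = λ f g →
        let (u , (u∘i₁ , u∘i₂) , unique) = universal g f
        in u , (u∘i₂ , u∘i₁) , λ v (v∘i₂ , v∘i₁) → unique v (v∘i₁ , v∘i₂) }
    where open Coproduct c

  IsPushout-jointly-epic : ∀ {A B C D} {f : Hom A B} {g : Hom A C} {g' : Hom B D} {f' : Hom C D}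
                           {X} {u v : Hom D X} → IsPushout 𝒞 f g g' f' →
                           u ∘ g' ≡ v ∘ g' → u ∘ f' ≡ v ∘ f' → u ≡ v
  IsPushout-jointly-epic {f = f} {g} {g'} {f'} {u = u} {v} po e₁ e₂ =
    trans (sym (unique u (e₁ , e₂))) (unique v (refl , refl))
    where
      commute : (v ∘ g') ∘ f ≡ (v ∘ f') ∘ g
      commute = trans (pullʳ v (IsPushout.commute po)) (sym (assoc v f' g))
      unique = proj₂ (proj₂ (IsPushout.universal po (v ∘ g') (v ∘ f') commute))

  IsPullback-jointly-monic : ∀ {A B C D} {f : Hom A B} {g : Hom A C} {g' : Hom B D} {f' : Hom C D}
                             {X} {u v : Hom X A} → IsPullback 𝒞 f g g' f' →
                             f ∘ u ≡ f ∘ v → g ∘ u ≡ g ∘ v → u ≡ v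
  IsPullback-jointly-monic {f = f} {g} {g'} {f'} {u = u} {v} pb e₁ e₂ =
    trans (sym (unique u (e₁ , e₂))) (unique v (refl , refl))
    where
      commute : g' ∘ (f ∘ v) ≡ f' ∘ (g ∘ v)
      commute = trans (pullˡ v (IsPullback.commute pb)) (assoc f' g v)
      unique = proj₂ (proj₂ (IsPullback.universal pb (f ∘ v) (g ∘ v) commute))

  IsPushout-id : ∀ {A C} (f : Hom A C) → IsPushout 𝒞 id f f id
  IsPushout-id f = record
    { commute = id-comm f
    ; universal = λ h k h∘id≡k∘f →
        k , (trans (sym h∘id≡k∘f) (identityʳ h) , identityʳ k)
          , λ y (_ , y∘id≡k) → trans (sym y∘id≡k) (identityʳ y) }

  IsPullback-id : ∀ {A C} (f : Hom A C) → IsPullback 𝒞 id f f id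
  IsPullback-id f = record
    { commute = id-comm f
    ; universal = λ h k f∘h≡id∘k →
        h , (identityˡ h , trans f∘h≡id∘k (identityˡ k))
          , λ y (id∘y≡h , _) → trans (sym id∘y≡h) (identityˡ y) }

  Mono⇒IsPullback : ∀ {A B} {f : Hom A B} → Mono 𝒞 f → IsPullback 𝒞 id id f f
  Mono⇒IsPullback mono = record
    { commute = refl
    ; universal = λ h k f∘h≡f∘k →
        h , (identityˡ h , trans (identityˡ h) (mono h k f∘h≡f∘k))
          , λ y (id∘y≡h , _) → trans (sym id∘y≡h) (identityˡ y) }

  IsPullback-swap : ∀ {A B C D} {f : Hom A B} {g : Hom A C} {g' : Hom B D} {f' : Hom C D} →
                    IsPullback 𝒞 f g g' f' → IsPullback 𝒞 g f f' g'
  IsPullback-swap pb = record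
    { commute = sym (IsPullback.commute pb)
    ; universal = λ h k eq →
        let (u , (f∘u , g∘u) , unique) = IsPullback.universal pb k h (sym eq)
        in u , (g∘u , f∘u) , λ y (g∘y , f∘y) → unique y (f∘y , g∘y) }

  IsPushout-id⇒IsIso : ∀ {A P D} {u : Hom A P} {g' : Hom A D} {f' : Hom P D} →
                       IsPushout 𝒞 id u g' f' → IsIso 𝒞 f'
  IsPushout-id⇒IsIso {u = u} {g'} {f'} po = record { inv = w ; invˡ = w∘f'≡id ; invʳ = f'∘w≡id }
    where
      W = IsPushout.universal po u id (id-comm u)
      w = proj₁ W
      w∘g'≡u = proj₁ (proj₁ (proj₂ W))
      w∘f'≡id = proj₂ (proj₁ (proj₂ W))
      f'∘w≡id : f' ∘ w ≡ id
      f'∘w≡id = IsPushout-jointly-epic po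
        (begin
          (f' ∘ w) ∘ g' ≡⟨ pullʳ f' w∘g'≡u ⟩
          f' ∘ u        ≡⟨ sym (IsPushout.commute po) ⟩
          g' ∘ id       ≡⟨ id-comm g' ⟩
          id ∘ g'       ∎)
        (trans (pullʳ f' w∘f'≡id) (id-comm f'))

  IsPushout-unglue :
    ∀ {A B C D E F} {a : Hom A B} {b : Hom A C} {c : Hom B D} {d : Hom C D}
      {x : Hom C E} {y : Hom D F} {d' : Hom E F} {b' : Hom A E} {c' : Hom B F} →
    IsPushout 𝒞 a b c d → y ∘ d ≡ d' ∘ x → IsPushout 𝒞 a b' c' d' →
    x ∘ b ≡ b' → y ∘ c ≡ c' → IsPushout 𝒞 d x y d'
  IsPushout-unglue {a = a} {b} {c} {d} {x} {y} {d'} {b'} {c'} inner sq outer x∘b≡b' y∘c≡c' =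
    record { commute = sq ; universal = universal }
    where
      universal : ∀ {X} (h : Hom _ X) (k : Hom _ X) → h ∘ d ≡ k ∘ x →
                  ∃![ w ∈ Hom _ X ] ((w ∘ y ≡ h) × (w ∘ d' ≡ k))
      universal h k h∘d≡k∘x = w , (w∘y≡h , w∘d'≡k) , unique
        where
          commute : (h ∘ c) ∘ a ≡ k ∘ b'
          commute = begin
            (h ∘ c) ∘ a ≡⟨ pullʳ h (IsPushout.commute inner) ⟩
            h ∘ (d ∘ b) ≡⟨ sym (assoc h d b) ⟩
            (h ∘ d) ∘ b ≡⟨ cong (_∘ b) h∘d≡k∘x ⟩
            (k ∘ x) ∘ b ≡⟨ pullʳ k x∘b≡b' ⟩
            k ∘ b'      ∎
          W = IsPushout.universal outer (h ∘ c) k commute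
          w = proj₁ W
          w∘c'≡h∘c = proj₁ (proj₁ (proj₂ W))
          w∘d'≡k = proj₂ (proj₁ (proj₂ W))
          w∘y≡h : w ∘ y ≡ h
          w∘y≡h = IsPushout-jointly-epic inner
            (trans (pullʳ w y∘c≡c') w∘c'≡h∘c)
            (begin
              (w ∘ y) ∘ d  ≡⟨ pullʳ w sq ⟩
              w ∘ (d' ∘ x) ≡⟨ pullˡ x w∘d'≡k ⟩
              k ∘ x        ≡⟨ sym h∘d≡k∘x ⟩
              h ∘ d        ∎)
          unique : ∀ v → (v ∘ y ≡ h) × (v ∘ d' ≡ k) → w ≡ v
          unique v (v∘y≡h , v∘d'≡k) = proj₂ (proj₂ W) v
            (trans (sym (pullʳ v y∘c≡c')) (cong (_∘ c) v∘y≡h) , v∘d'≡k)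

  coproduct-pushout : ∀ {I L L'} (cI : Coproduct 𝒞 I L') (cL : Coproduct 𝒞 L L') (l : Hom I L) →
                      IsPushout 𝒞 l (Coproduct.i₁ cI) (Coproduct.i₁ cL)
                        (copair 𝒞 cI (Coproduct.i₁ cL ∘ l) (Coproduct.i₂ cL))
  coproduct-pushout cI cL l = record { commute = sym (copair-i₁ cI _ _) ; universal = universal }
    where
      open Coproduct cI using () renaming (i₁ to ι₁; i₂ to ι₂)
      open Coproduct cL using () renaming (i₁ to j₁; i₂ to j₂)
      l+L' = copair 𝒞 cI (j₁ ∘ l) j₂
      universal : ∀ {X} (h : Hom _ X) (k : Hom _ X) → h ∘ l ≡ k ∘ ι₁ →
                  ∃![ w ∈ Hom _ X ] ((w ∘ j₁ ≡ h) × (w ∘ l+L' ≡ k))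
      universal h k h∘l≡k∘ι₁ = w , (w∘j₁≡h , w∘l+L'≡k) , unique
        where
          w = copair 𝒞 cL h (k ∘ ι₂)
          w∘j₁≡h = copair-i₁ cL h (k ∘ ι₂)
          w∘l+L'≡k : w ∘ l+L' ≡ k
          w∘l+L'≡k = coproduct-ext cI
            (begin
              (w ∘ l+L') ∘ ι₁ ≡⟨ pullʳ w (copair-i₁ cI _ _) ⟩
              w ∘ (j₁ ∘ l)    ≡⟨ pullˡ l w∘j₁≡h ⟩
              h ∘ l           ≡⟨ h∘l≡k∘ι₁ ⟩
              k ∘ ι₁          ∎)
            (trans (pullʳ w (copair-i₂ cI _ _)) (copair-i₂ cL h (k ∘ ι₂)))
          unique : ∀ v → (v ∘ j₁ ≡ h) × (v ∘ l+L' ≡ k) → w ≡ v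
          unique v (v∘j₁≡h , v∘l+L'≡k) = coproduct-ext cL
            (trans w∘j₁≡h (sym v∘j₁≡h))
            (begin
              w ∘ j₂             ≡⟨ copair-i₂ cL h (k ∘ ι₂) ⟩
              k ∘ ι₂             ≡⟨ cong (_∘ ι₂) (sym v∘l+L'≡k) ⟩
              (v ∘ l+L') ∘ ι₂    ≡⟨ pullʳ v (copair-i₂ cI _ _) ⟩
              v ∘ j₂             ∎)

module MAdhesiveProperties {o ℓ m : Level} {𝒞 : Category o ℓ} (𝓜 : MAdhesive 𝒞 m) where
  open Category 𝒞
  open MAdhesive 𝓜
  open CategoryProperties 𝒞
  open ≡-Reasoning

  id∈M : ∀ {A} → M (id {A})
  id∈M = M-iso id (record { inv = id ; invˡ = identityˡ id ; invʳ = identityˡ id })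

  M-pushout⇒pullback : ∀ {A B C D} {f : Hom A B} {g : Hom A C} {g' : Hom B D} {f' : Hom C D} →
                       M f → IsPushout 𝒞 f g g' f' → IsPullback 𝒞 f g g' f'
  M-pushout⇒pullback {f = f} {g} {g'} {f'} f∈M po =
    proj₁ (proj₁ (van-Kampen f g g' f' f∈M po id g g id id f id f'
      (id-comm g) refl (id-comm g) (IsPushout.commute po) refl
      f∈M id∈M f'∈M (Mono⇒IsPullback (M-mono f f∈M)) (IsPullback-id g))
      (IsPushout-id g))
    where f'∈M = M-pushout-stable f g g' f' po f∈M

  -- The cube has bottom face the first pushout, front faces the second
  -- pushout and the given pullback, and top face (id , u , f' , p') where
  -- u : A → P is induced by f and f'; van Kampen makes the top a pushout.
  pushout-complement-iso :
    ∀ {A B C C' D P} {mo : Hom A B} {f : Hom A C} {f' : Hom A C'} {g : Hom B D}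
      {n : Hom C D} {n' : Hom C' D} {p : Hom P C} {p' : Hom P C'} →
    M mo → IsPushout 𝒞 mo f g n → IsPushout 𝒞 mo f' g n' →
    IsPullback 𝒞 p p' n n' → M p → IsIso 𝒞 p'
  pushout-complement-iso {mo = mo} {f} {f'} {g} {n} {n'} {p} {p'} mo∈M po po' pb p∈M =
    IsPushout-id⇒IsIso top
    where
      n'∈M = M-pushout-stable mo f' g n' po' mo∈M
      n∘f≡n'∘f' : n ∘ f ≡ n' ∘ f'
      n∘f≡n'∘f' = trans (sym (IsPushout.commute po)) (IsPushout.commute po')
      U = IsPullback.universal pb f f' n∘f≡n'∘f'
      u = proj₁ U
      p∘u≡f = proj₁ (proj₁ (proj₂ U))
      p'∘u≡f' = proj₂ (proj₁ (proj₂ U))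
      u-factor : ∀ {X} (h : Hom X _) (k : Hom X _) → f ∘ h ≡ p ∘ k → u ∘ h ≡ k
      u-factor h k f∘h≡p∘k = IsPullback-jointly-monic pb
        (trans (pullˡ h p∘u≡f) f∘h≡p∘k)
        (trans (pullˡ h p'∘u≡f') (M-mono n' n'∈M (f' ∘ h) (p' ∘ k) (begin
          n' ∘ (f' ∘ h) ≡⟨ pullˡ h (sym n∘f≡n'∘f') ⟩
          (n ∘ f) ∘ h   ≡⟨ pullʳ n f∘h≡p∘k ⟩
          n ∘ (p ∘ k)   ≡⟨ pullˡ k (IsPullback.commute pb) ⟩
          (n' ∘ p') ∘ k ≡⟨ assoc n' p' k ⟩
          n' ∘ (p' ∘ k) ∎)))
      back : IsPullback 𝒞 id u f p
      back = record
        { commute = trans (identityʳ f) (sym p∘u≡f)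
        ; universal = λ h k f∘h≡p∘k →
            h , (identityˡ h , u-factor h k f∘h≡p∘k)
              , λ y (id∘y≡h , _) → trans (sym id∘y≡h) (identityˡ y) }
      top : IsPushout 𝒞 id u f' p'
      top = proj₂ (van-Kampen mo f g n mo∈M po id u f' p' id mo p n'
              (trans (identityʳ f') (sym p'∘u≡f')) refl (trans (identityʳ f) (sym p∘u≡f))
              (IsPushout.commute po') (IsPullback.commute pb)
              mo∈M p∈M n'∈M (Mono⇒IsPullback (M-mono mo mo∈M)) back)
              (M-pushout⇒pullback mo∈M po') pb

  pushout-complement-comparison :
    ∀ {A B C C' D} {mo : Hom A B} {f : Hom A C} {f' : Hom A C'} {g : Hom B D}
      {n : Hom C D} {n' : Hom C' D} →
    M mo → IsPushout 𝒞 mo f g n → IsPushout 𝒞 mo f' g n' →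
    Σ[ φ ∈ Hom C C' ] (φ ∘ f ≡ f') × (n' ∘ φ ≡ n)
  pushout-complement-comparison {mo = mo} {f} {f'} {g} {n} {n'} mo∈M po po' =
    q' ∘ q⁻¹ , φ∘f≡f' , n'∘φ≡n
    where
      n∈M = M-pushout-stable mo f g n po mo∈M
      n'∈M = M-pushout-stable mo f' g n' po' mo∈M
      Q = pullback-M n' n n'∈M
      q' = proj₁ (proj₂ Q)
      q = proj₁ (proj₂ (proj₂ Q))
      pb = proj₂ (proj₂ (proj₂ Q))
      q'∈M = M-pullback-stable q q' n n' (IsPullback-swap pb) n∈M
      q-iso = pushout-complement-iso mo∈M po' po pb q'∈M
      q⁻¹ = IsIso.inv q-iso
      U = IsPullback.universal pb f' f (trans (sym (IsPushout.commute po')) (IsPushout.commute po))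
      u = proj₁ U
      q'∘u≡f' = proj₁ (proj₁ (proj₂ U))
      q∘u≡f = proj₂ (proj₁ (proj₂ U))
      φ∘f≡f' : (q' ∘ q⁻¹) ∘ f ≡ f'
      φ∘f≡f' = begin
        (q' ∘ q⁻¹) ∘ f       ≡⟨ cong ((q' ∘ q⁻¹) ∘_) (sym q∘u≡f) ⟩
        (q' ∘ q⁻¹) ∘ (q ∘ u) ≡⟨ pullʳ q' (pullˡ u (IsIso.invˡ q-iso)) ⟩
        q' ∘ (id ∘ u)        ≡⟨ cong (q' ∘_) (identityˡ u) ⟩
        q' ∘ u               ≡⟨ q'∘u≡f' ⟩
        f'                   ∎
      n'∘φ≡n : n' ∘ (q' ∘ q⁻¹) ≡ n
      n'∘φ≡n = begin
        n' ∘ (q' ∘ q⁻¹) ≡⟨ pullˡ q⁻¹ (IsPullback.commute pb) ⟩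
        (n ∘ q) ∘ q⁻¹   ≡⟨ pullʳ n (IsIso.invʳ q-iso) ⟩
        n ∘ id          ≡⟨ identityʳ n ⟩
        n               ∎

  extension-along-coproduct :
    (p : Rule 𝓜) {L' G : Obj} (cL : Coproduct 𝒞 (Rule.L p) L') (cI : Coproduct 𝒞 (Rule.I p) L')
    {mt : Hom (Rule.L p) G} {m' : Hom L' G} (f : Hom (Coproduct.A+B cL) G) →
    f ∘ Coproduct.i₁ cL ≡ mt → f ∘ Coproduct.i₂ cL ≡ m' →
    (t : DirectTransformation 𝓜 p mt) (d' : Hom L' (DirectTransformation.D t)) →
    DirectTransformation.k t ∘ d' ≡ m' →
    (u : DirectTransformation 𝓜 p (Coproduct.i₁ cL)) → ExtensionDiagram 𝓜 p u t f
  extension-along-coproduct p cL cI {mt} f f∘i₁≡mt f∘i₂≡m' t d' k∘d'≡m' u = record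
    { match-eq = sym f∘i₁≡mt ; dD = dD ; hH = hH ; I-eq = dD∘d≡d ; R-eq = hH∘n≡n
    ; left-po = IsPushout-unglue U.left f∘k≡k∘dD T.left dD∘d≡d f∘i₁≡mt
    ; right-po = IsPushout-unglue U.right hH∘c≡c∘dD T.right dD∘d≡d hH∘n≡n }
    where
      open Rule p
      module U = DirectTransformation u
      module T = DirectTransformation t
      open Coproduct cI using () renaming (i₁ to ι₁; i₂ to ι₂)
      open Coproduct cL using () renaming (i₁ to j₁; i₂ to j₂)
      l+L' = copair 𝒞 cI (j₁ ∘ l) j₂
      comparison = pushout-complement-comparison l∈M U.left (coproduct-pushout cI cL l)
      φ = proj₁ comparison
      φ∘d≡ι₁ = proj₁ (proj₂ comparison)
      l+L'∘φ≡k = proj₂ (proj₂ comparison)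
      d+d' = copair 𝒞 cI T.d d'
      dD = d+d' ∘ φ
      dD∘d≡d : dD ∘ U.d ≡ T.d
      dD∘d≡d = trans (pullʳ d+d' φ∘d≡ι₁) (copair-i₁ cI T.d d')
      f∘l+L'≡k∘d+d' : f ∘ l+L' ≡ T.k ∘ d+d'
      f∘l+L'≡k∘d+d' = coproduct-ext cI
        (begin
          (f ∘ l+L') ∘ ι₁  ≡⟨ pullʳ f (copair-i₁ cI _ _) ⟩
          f ∘ (j₁ ∘ l)     ≡⟨ pullˡ l f∘i₁≡mt ⟩
          mt ∘ l           ≡⟨ IsPushout.commute T.left ⟩
          T.k ∘ T.d        ≡⟨ sym (pullʳ T.k (copair-i₁ cI T.d d')) ⟩
          (T.k ∘ d+d') ∘ ι₁ ∎)
        (begin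
          (f ∘ l+L') ∘ ι₂  ≡⟨ pullʳ f (copair-i₂ cI _ _) ⟩
          f ∘ j₂           ≡⟨ trans f∘i₂≡m' (sym k∘d'≡m') ⟩
          T.k ∘ d'         ≡⟨ sym (pullʳ T.k (copair-i₂ cI T.d d')) ⟩
          (T.k ∘ d+d') ∘ ι₂ ∎)
      f∘k≡k∘dD : f ∘ U.k ≡ T.k ∘ dD
      f∘k≡k∘dD = begin
        f ∘ U.k            ≡⟨ cong (f ∘_) (sym l+L'∘φ≡k) ⟩
        f ∘ (l+L' ∘ φ)     ≡⟨ pullˡ φ f∘l+L'≡k∘d+d' ⟩
        (T.k ∘ d+d') ∘ φ   ≡⟨ assoc T.k d+d' φ ⟩
        T.k ∘ dD           ∎
      H = IsPushout.universal U.right T.n (T.c ∘ dD)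
            (trans (IsPushout.commute T.right) (sym (pullʳ T.c dD∘d≡d)))
      hH = proj₁ H
      hH∘n≡n = proj₁ (proj₁ (proj₂ H))
      hH∘c≡c∘dD = proj₂ (proj₁ (proj₂ H))

lemma5 : {o ℓ m : Level} (𝒞 : Category o ℓ) (𝓜 : MAdhesive 𝒞 m)
         (cop : BinaryCoproducts 𝒞) (p₁ p₂ : Rule 𝓜)
         {G : Category.Obj 𝒞}
         {m₁ : Category.Hom 𝒞 (Rule.L p₁) G}
         {m₂ : Category.Hom 𝒞 (Rule.L p₂) G}
         (t₁ : DirectTransformation 𝓜 p₁ m₁)
         (t₂ : DirectTransformation 𝓜 p₂ m₂) →
         ParallelIndependent 𝓜 t₁ t₂ →
         (u₁ : DirectTransformation 𝓜 p₁ (Coproduct.i₁ (cop (Rule.L p₁) (Rule.L p₂))))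
         (u₂ : DirectTransformation 𝓜 p₂ (Coproduct.i₂ (cop (Rule.L p₁) (Rule.L p₂)))) →
         Embeds 𝓜 u₁ u₂ t₁ t₂ (copair 𝒞 (cop (Rule.L p₁) (Rule.L p₂)) m₁ m₂)
lemma5 𝒞 𝓜 cop p₁ p₂ {m₁ = m₁} {m₂} t₁ t₂ (d₁₂ , k₂∘d₁₂≡m₁ , d₂₁ , k₁∘d₂₁≡m₂) u₁ u₂ =
    extension-along-coproduct p₁ c (cop (Rule.I p₁) (Rule.L p₂)) f
      (copair-i₁ c m₁ m₂) (copair-i₂ c m₁ m₂) t₁ d₂₁ k₁∘d₂₁≡m₂ u₁
  , extension-along-coproduct p₂ (Coproduct-swap c) (cop (Rule.I p₂) (Rule.L p₁)) f
      (copair-i₂ c m₁ m₂) (copair-i₁ c m₁ m₂) t₂ d₁₂ k₂∘d₁₂≡m₁ u₂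
  where
    open CategoryProperties 𝒞
    open MAdhesiveProperties 𝓜
    c = cop (Rule.L p₁) (Rule.L p₂)
    f = copair 𝒞 c m₁ m₂
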